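{- Let $F$ be a transition formula over $X$. Then for every $\langle r,a\rangle\in\mathrm{rec}(F)$, $\exp(F,t)\models_{\mathbf{LIRR}}r'\le r+ta$.
   Context: $X$ is a finite set of symbols, $X'=\{x':x\in X\}$. A transition formula is a ground $\sigma^Z_{or}(X\cup X')$-formula ($\sigma^Z_{or}$: $+,\cdot,0,1,=,\le$ and unary $\mathit{Int}$). $\mathbf{LIRR}$: commutative ring axioms; $\le$ reflexive, transitive, antisymmetric; $x\le y\Rightarrow x+z\le y+z$; $0\le1\land0\ne1$; for each integer $n\ge1$, $\exists x\,(nx=1)$ and $\forall x\,(0\le nx\Rightarrow0\le x)$; $\mathit{Int}(1)$; $\mathit{Int}$ closed under $+$ and additive inverses; for integers $n>0$, $m$: $\forall x(\mathit{Int}(x)\land0\le nx+m\Rightarrow0\le x+\lfloor m/n\rfloor)$. $(\cdot)'$ is the ring homomorphism $x\mapsto x'$. $\mathrm{Cn}(F)=\{p\in\mathbb{Q}[X\cup X']:F\models_{\mathbf{LIRR}}0\le p\}$. $\mathrm{LinInv}(F)=\{k\in\mathrm{span}_{\mathbb{Q}}(X):F\models_{\mathbf{LIRR}}k'=k\}$ with basis $a_1,\dots,a_n$; $\mathrm{Inv}(F)$ is the subring of $\mathbb{Q}[X]$ generated by $\mathrm{LinInv}(F)$; $\mathrm{rec}(F)=\{\langle r,a\rangle\in\mathrm{span}_{\mathbb{Q}}(X)\times\mathrm{Inv}(F):F\models_{\mathbf{LIRR}}r'\le r+a\}$. Fresh variables $D=\{d_x:x\in X\}$, $K=\{k_1,\dots,k_n\}$;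 ring homomorphisms $\delta:d_x\mapsto x-x'$, $\mathit{inv}:k_i\mapsto a_i$, and their common extension $\delta_{inv}:\mathbb{Q}[D\cup K]\to\mathbb{Q}[X\cup X']$. Each $p\in\mathrm{span}_{\mathbb{Q}}(D)+\mathbb{Q}[K]$ decomposes uniquely as $\pi_D(p)+\pi_K(p)$ with $\pi_D(p)\in\mathrm{span}_{\mathbb{Q}}(D)$, $\pi_K(p)\in\mathbb{Q}[K]$. $V\subseteq\mathbb{Q}[K]$ and $R\subseteq\mathrm{span}_{\mathbb{Q}}(D)+\mathbb{Q}[K]$ are the finite sets produced by the paper's algorithm, satisfying $\mathbb{Q}[K]\cdot V+\mathrm{cone}(R)=\delta_{inv}^{ -1}(\mathrm{Cn}(F))\cap(\mathrm{span}_{\mathbb{Q}}(D)+\mathbb{Q}[K])$ and $F\models_{\mathbf{LIRR}}\delta_{inv}(v)=0$ for $v\in V$. For a fresh constant $t$, $\mathit{cf}(p)=\delta(\pi_D(p))+t\cdot\mathit{inv}(\pi_K(p))$ and $\exp(F,t)=\bigwedge_{v\in V}0=\mathit{cf}(v)\land\bigwedge_{r\in R}0\le\mathit{cf}(r)$. -}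

module Defs where

open import Level using (Level) renaming (suc to lsuc; zero to lzero)
open import Data.Nat as ℕ using (ℕ; zero; suc)
open import Data.Integer as ℤ using (ℤ; +_; -[1+_])
open import Data.Integer.DivMod using (_/ℕ_)
open import Data.Rational as ℚ using (ℚ; 0ℚ; 1ℚ)
open import Data.Fin using (Fin; zero; suc)
open import Data.Sum using (_⊎_; inj₁; inj₂; [_,_])
open import Data.Unit using (⊤; tt)
open import Data.Empty using (⊥)
open import Data.Product using (Σ; _×_; _,_; ∃)
open import Function using (_∘_)
open import Relation.Binary.PropositionalEquality using (_≡_; _≢_)
open import Relation.Nullary using (¬_)

natMul : {A : Set} → (A → A → A) → A → ℕ → A → A
natMul _+_ 0# zero    x = 0#
natMul _+_ 0# (suc n) x = x + natMul _+_ 0# n x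

intEmb : {A : Set} → (A → A → A) → (A → A) → A → A → ℤ → A
intEmb _+_ -_ 0# 1# (+ n)     = natMul _+_ 0# n 1#
intEmb _+_ -_ 0# 1# -[1+ n ]  = - natMul _+_ 0# (suc n) 1#

-- Models of LIRR (signature σ^Z_or : + · 0 1 = ≤ Int), with equality
-- interpreted as identity.  Existential axioms are given by witnesses
-- (the witnesses are unique in every model, so this is harmless).

record Model : Set₁ where
  infixl 6 _+_
  infixl 7 _*_
  infix  4 _≤_
  field
    Carrier : Set
    _+_ _*_ : Carrier → Carrier → Carrier
    0# 1#   : Carrier
    _≤_     : Carrier → Carrier → Set
    Int     : Carrier → Set
    -_       : Carrier → Carrier
    +-assoc  : ∀ x y z → (x + y) + z ≡ x + (y + z)
    +-comm   : ∀ x y → x + y ≡ y + x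
    +-idˡ    : ∀ x → 0# + x ≡ x
    +-invʳ   : ∀ x → x + (- x) ≡ 0#
    *-assoc  : ∀ x y z → (x * y) * z ≡ x * (y * z)
    *-comm   : ∀ x y → x * y ≡ y * x
    *-idˡ    : ∀ x → 1# * x ≡ x
    distribˡ : ∀ x y z → x * (y + z) ≡ (x * y) + (x * z)
    ≤-refl    : ∀ x → x ≤ x
    ≤-trans   : ∀ x y z → x ≤ y → y ≤ z → x ≤ z
    ≤-antisym : ∀ x y → x ≤ y → y ≤ x → x ≡ y
    ≤-+       : ∀ x y z → x ≤ y → x + z ≤ y + z
    0≤1       : 0# ≤ 1#
    0≢1       : 0# ≢ 1#
    divisible : ∀ n → Σ Carrier (λ x → natMul _+_ 0# (suc n) x ≡ 1#)
    ≤-cancel  : ∀ n x → 0# ≤ natMul _+_ 0# (suc n) x → 0# ≤ x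
    Int-1     : Int 1#
    Int-+     : ∀ x y → Int x → Int y → Int (x + y)
    Int--     : ∀ x → Int x → Int (- x)
    Int-floor : ∀ (n : ℕ) (m : ℤ) x → Int x →
                0# ≤ natMul _+_ 0# (suc n) x + intEmb _+_ -_ 0# 1# m →
                0# ≤ x + intEmb _+_ -_ 0# 1# (m /ℕ suc n)

  ⟦_⟧ℤ : ℤ → Carrier
  ⟦_⟧ℤ = intEmb _+_ -_ 0# 1#

  ⟦_⟧ℚ : ℚ → Carrier
  ⟦ q ⟧ℚ = ⟦ ℚ.numerator q ⟧ℤ * Data.Product.proj₁ (divisible (ℚ.denominator-1 q))

data STerm (S : Set) : Set where
  svar  : S → STerm S
  szero sone : STerm S
  _s+_ _s*_ : STerm S → STerm S → STerm S

-- Polynomial expressions with rational coefficients; ℚ[S] is Poly S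
-- modulo _≈ₚ_ (the free commutative ℚ-algebra on S).

infixl 6 _⊕_
infixl 7 _⊗_
data Poly (S : Set) : Set where
  var : S → Poly S
  con : ℚ → Poly S
  _⊕_ _⊗_ : Poly S → Poly S → Poly S

infix 4 _≈ₚ_
data _≈ₚ_ {S : Set} : Poly S → Poly S → Set where
  ≈-refl   : ∀ {p} → p ≈ₚ p
  ≈-sym    : ∀ {p q} → p ≈ₚ q → q ≈ₚ p
  ≈-trans  : ∀ {p q r} → p ≈ₚ q → q ≈ₚ r → p ≈ₚ r
  ⊕-cong   : ∀ {p p' q q'} → p ≈ₚ p' → q ≈ₚ q' → p ⊕ q ≈ₚ p' ⊕ q'
  ⊗-cong   : ∀ {p p' q q'} → p ≈ₚ p' → q ≈ₚ q' → p ⊗ q ≈ₚ p' ⊗ q'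
  ⊕-assoc  : ∀ p q r → (p ⊕ q) ⊕ r ≈ₚ p ⊕ (q ⊕ r)
  ⊕-comm   : ∀ p q → p ⊕ q ≈ₚ q ⊕ p
  ⊕-idˡ    : ∀ p → con 0ℚ ⊕ p ≈ₚ p
  ⊕-invʳ   : ∀ p → p ⊕ (con (ℚ.- 1ℚ) ⊗ p) ≈ₚ con 0ℚ
  ⊗-assoc  : ∀ p q r → (p ⊗ q) ⊗ r ≈ₚ p ⊗ (q ⊗ r)
  ⊗-comm   : ∀ p q → p ⊗ q ≈ₚ q ⊗ p
  ⊗-idˡ    : ∀ p → con 1ℚ ⊗ p ≈ₚ p
  distribˡ : ∀ p q r → p ⊗ (q ⊕ r) ≈ₚ (p ⊗ q) ⊕ (p ⊗ r)
  con-+    : ∀ a b → con (a ℚ.+ b) ≈ₚ con a ⊕ con b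
  con-*    : ∀ a b → con (a ℚ.* b) ≈ₚ con a ⊗ con b

subst : {S T : Set} → (S → Poly T) → Poly S → Poly T
subst σ (var x) = σ x
subst σ (con c) = con c
subst σ (p ⊕ q) = subst σ p ⊕ subst σ q
subst σ (p ⊗ q) = subst σ p ⊗ subst σ q

ren : {S T : Set} → (S → T) → Poly S → Poly T
ren f = subst (var ∘ f)

sumP : {S : Set} {k : ℕ} → (Fin k → Poly S) → Poly S
sumP {k = zero}  f = con 0ℚ
sumP {k = suc k} f = f zero ⊕ sumP (f ∘ suc)

sumℚ : {k : ℕ} → (Fin k → ℚ) → ℚ
sumℚ {zero}  f = 0ℚ
sumℚ {suc k} f = f zero ℚ.+ sumℚ (f ∘ suc)

infix 4 _=ᶠ_ _≤ᶠ_
infixr 3 _∧ᶠ_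
infixr 2 _∨ᶠ_
data Fml (T : Set) : Set where
  _=ᶠ_ _≤ᶠ_ : T → T → Fml T
  Intᶠ      : T → Fml T
  ⊤ᶠ        : Fml T
  ¬ᶠ_       : Fml T → Fml T
  _∧ᶠ_ _∨ᶠ_ : Fml T → Fml T → Fml T

module _ (M : Model) where
  open Model M

  evalS : {S : Set} → (S → Carrier) → STerm S → Carrier
  evalS ρ (svar x) = ρ x
  evalS ρ szero    = 0#
  evalS ρ sone     = 1#
  evalS ρ (s s+ t) = evalS ρ s + evalS ρ t
  evalS ρ (s s* t) = evalS ρ s * evalS ρ t

  evalP : {S : Set} → (S → Carrier) → Poly S → Carrier
  evalP ρ (var x) = ρ x
  evalP ρ (con c) = ⟦ c ⟧ℚ
  evalP ρ (p ⊕ q) = evalP ρ p + evalP ρ q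
  evalP ρ (p ⊗ q) = evalP ρ p * evalP ρ q

  Sat : {T : Set} → (T → Carrier) → Fml T → Set
  Sat ev (s =ᶠ t) = ev s ≡ ev t
  Sat ev (s ≤ᶠ t) = ev s ≤ ev t
  Sat ev (Intᶠ t) = Int (ev t)
  Sat ev ⊤ᶠ       = ⊤
  Sat ev (¬ᶠ φ)   = ¬ Sat ev φ
  Sat ev (φ ∧ᶠ ψ) = Sat ev φ × Sat ev ψ
  Sat ev (φ ∨ᶠ ψ) = Sat ev φ ⊎ Sat ev ψ

⋀ : {T : Set} {k : ℕ} → (Fin k → Fml T) → Fml T
⋀ {k = zero}  f = ⊤ᶠ
⋀ {k = suc k} f = f zero ∧ᶠ ⋀ (f ∘ suc)

-- Symbols.  X = Fin m;  X ∪ X' = Fin m ⊎ Fin m  (inj₁ x = x, inj₂ x = x').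

Sym : ℕ → Set
Sym m = Fin m ⊎ Fin m

TransFormula : ℕ → Set
TransFormula m = Fml (STerm (Sym m))

PFml : Set → Set
PFml S = Fml (Poly S)

_⊨ᵀ_ : {m : ℕ} → TransFormula m → PFml (Sym m) → Set₁
_⊨ᵀ_ {m} F ψ = (M : Model) (ρ : Sym m → Model.Carrier M) →
               Sat M (evalS M ρ) F → Sat M (evalP M ρ) ψ

_⊨ᴾ_ : {S : Set} → PFml S → PFml S → Set₁
_⊨ᴾ_ {S} φ ψ = (M : Model) (ρ : S → Model.Carrier M) →
               Sat M (evalP M ρ) φ → Sat M (evalP M ρ) ψ

unp : {m : ℕ} → Poly (Fin m) → Poly (Sym m)
unp = ren inj₁

infix 10 _′
_′ : {m : ℕ} → Poly (Fin m) → Poly (Sym m)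
p ′ = ren inj₂ p

-- span_ℚ(X): linear forms given by their coefficient vectors
LinForm : ℕ → Set
LinForm m = Fin m → ℚ

lin : {m : ℕ} → LinForm m → Poly (Fin m)
lin c = sumP (λ i → con (c i) ⊗ var i)

Cn : {m : ℕ} → TransFormula m → Poly (Sym m) → Set₁
Cn F p = F ⊨ᵀ (con 0ℚ ≤ᶠ p)

LinInv : {m : ℕ} → TransFormula m → LinForm m → Set₁
LinInv F k = F ⊨ᵀ ((lin k) ′ =ᶠ unp (lin k))

IsBasisLinInv : {m n : ℕ} → TransFormula m → (Fin n → LinForm m) → Set₁
IsBasisLinInv {m} {n} F a =
  ((i : Fin n) → LinInv F (a i)) ×
  ((k : LinForm m) → LinInv F k →
     Σ (Fin n → ℚ) λ λs → (j : Fin m) → k j ≡ sumℚ (λ i → λs i ℚ.* a i j)) ×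
  ((λs : Fin n → ℚ) → ((j : Fin m) → sumℚ (λ i → λs i ℚ.* a i j) ≡ 0ℚ) →
     (i : Fin n) → λs i ≡ 0ℚ)

-- D = {d_x : x ∈ X} ≅ Fin m,  K = {k_1..k_n} ≅ Fin n

δ : {m : ℕ} → Poly (Fin m) → Poly (Sym m)
δ = subst (λ x → var (inj₁ x) ⊕ con (ℚ.- 1ℚ) ⊗ var (inj₂ x))

inv : {m n : ℕ} → (Fin n → LinForm m) → Poly (Fin n) → Poly (Fin m)
inv a = subst (λ i → lin (a i))

δinv : {m n : ℕ} → (Fin n → LinForm m) → Poly (Fin m ⊎ Fin n) → Poly (Sym m)
δinv a = subst [ (λ x → δ (var x)) , (λ i → unp (lin (a i))) ]

-- Inv(F) = inv(ℚ[K]), the subalgebra of ℚ[X] generated by LinInv(F)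
InInv : {m n : ℕ} → (Fin n → LinForm m) → Poly (Fin m) → Set
InInv {n = n} a p = Σ (Poly (Fin n)) λ q → p ≈ₚ inv a q

InRec : {m n : ℕ} → TransFormula m → (Fin n → LinForm m) →
        LinForm m → Poly (Fin m) → Set₁
InRec F a r p = InInv a p × F ⊨ᵀ ((lin r) ′ ≤ᶠ unp (lin r) ⊕ unp p)

-- elements of span_ℚ(D) + ℚ[K], via their (unique) decomposition (π_D, π_K)
DK : ℕ → ℕ → Set
DK m n = LinForm m × Poly (Fin n)

embedDK : {m n : ℕ} → DK m n → Poly (Fin m ⊎ Fin n)
embedDK (c , q) = ren inj₁ (lin c) ⊕ ren inj₂ q

InModCone : {m n nv nr : ℕ} → (Fin nv → Poly (Fin n)) → (Fin nr → DK m n) →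
            Poly (Fin m ⊎ Fin n) → Set
InModCone {m} {n} {nv} {nr} V R p =
  Σ (Fin nv → Poly (Fin n)) λ qs → Σ (Fin nr → ℚ) λ λs →
    ((j : Fin nr) → 0ℚ ℚ.≤ λs j) ×
    (p ≈ₚ sumP (λ i → ren inj₂ (qs i) ⊗ ren inj₂ (V i))
          ⊕ sumP (λ j → con (λs j) ⊗ embedDK (R j)))

ModConeSpec : {m n nv nr : ℕ} → TransFormula m → (Fin n → LinForm m) →
              (Fin nv → Poly (Fin n)) → (Fin nr → DK m n) → Set₁
ModConeSpec {m} {n} F a V R =
  (p : Poly (Fin m ⊎ Fin n)) →
    (InModCone V R p → Cn F (δinv a p) × Σ (DK m n) (λ d → p ≈ₚ embedDK d)) ×
    (Cn F (δinv a p) × Σ (DK m n) (λ d → p ≈ₚ embedDK d) → InModCone V R p)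

-- exp(F, t):  symbols X ∪ X' ∪ {t}

SymT : ℕ → Set
SymT m = Sym m ⊎ ⊤

tvar : {m : ℕ} → Poly (SymT m)
tvar = var (inj₂ tt)

liftT : {m : ℕ} → Poly (Sym m) → Poly (SymT m)
liftT = ren inj₁

cf : {m n : ℕ} → (Fin n → LinForm m) → DK m n → Poly (SymT m)
cf a (c , q) = liftT (δ (lin c)) ⊕ tvar ⊗ liftT (unp (inv a q))

zeroLin : {m : ℕ} → LinForm m
zeroLin _ = 0ℚ

expF : {m n nv nr : ℕ} → (Fin n → LinForm m) →
       (Fin nv → Poly (Fin n)) → (Fin nr → DK m n) → PFml (SymT m)
expF a V R = ⋀ (λ i → con 0ℚ =ᶠ cf a (zeroLin , V i))
          ∧ᶠ ⋀ (λ j → con 0ℚ ≤ᶠ cf a (R j))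

{-# OPTIONS --safe #-}
module Submission where

-- Write a = inv(q) with q ∈ ℚ[K]. Since ⟨r, a⟩ ∈ rec(F), F ⊨ 0 ≤ (r − r') + inv(q) = δ_inv(d_r + q), so by the
-- description of the cone d_r + q = Σᵢ qᵢ vᵢ + Σⱼ λⱼ rⱼ in ℚ[D ∪ K] with λⱼ ≥ 0.  In a model of exp(F, t)
-- evaluate both sides twice, once along δ_inv (d_x ↦ x − x') and once with d_x ↦ 0, both with k_i ↦ a_i.
-- The functional Φ p = (first − second) + t · second is additive and ℚ-linear; on span(D) + ℚ[K] it is cf,
-- so Φ(rⱼ) ≥ 0, and Φ(qᵢ vᵢ) = inv(qᵢ) · t · inv(vᵢ) = 0.  Hence 0 ≤ Φ(d_r + q) = (r − r') + t · a.

open import Defs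
open import Data.Nat as ℕ using (ℕ; zero; suc)
open import Data.Fin using (Fin; zero; suc)
open import Data.Sum using (_⊎_; inj₁; inj₂; [_,_])
open import Data.Unit using (tt)
open import Data.Empty using (⊥-elim)
open import Data.Product using (_,_; proj₁; proj₂)
import Data.Maybe as Maybe
open import Data.Integer as ℤ using (-[1+_])
import Data.Integer.Properties as ℤ
import Data.Nat.Properties as ℕ
open import Data.Sign as Sign using (Sign)
open import Data.Rational as ℚ using (0ℚ; 1ℚ)
import Data.Rational.Properties as ℚ
import Data.Rational.Unnormalised as ℚᵘ
open import Function using (_∘_)
open import Relation.Binary.Consequences using (dec⇒weaklyDec)
open import Relation.Binary.PropositionalEquality
  using (_≡_; refl; sym; trans; cong; cong₂; subst₂; isEquivalence; module ≡-Reasoning)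
open import Algebra.Bundles using (CommutativeRing; Ring)
open import Algebra.Structures using (IsCommutativeRing)
open import Algebra.Consequences.Propositional
  using (comm∧idˡ⇒id; comm∧invʳ⇒inv; comm∧distrˡ⇒distrʳ)
import Algebra.Solver.Ring.AlmostCommutativeRing as ACR
import Algebra.Properties.Ring as RingProperties
import Algebra.Properties.RingWithoutOne as RingWithoutOneProperties
import Algebra.Properties.Group as GroupProperties
import Algebra.Properties.AbelianGroup as AbelianGroupProperties
import Algebra.Properties.CommutativeSemigroup as CommutativeSemigroupProperties
import Algebra.Properties.Monoid.Mult as MonoidMult
import Algebra.Properties.Semiring.Mult as SemiringMult
import Algebra.Properties.Semiring.Sum as SemiringSum

open ≡-Reasoning

module ModelProperties (M : Model) where
  open Model M

  isCommutativeRing : IsCommutativeRing _≡_ _+_ _*_ -_ 0# 1#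
  isCommutativeRing = record
    { isRing = record
      { +-isAbelianGroup = record
        { isGroup = record
          { isMonoid = record
            { isSemigroup = record
              { isMagma = record { isEquivalence = isEquivalence ; ∙-cong = cong₂ _+_ }
              ; assoc = +-assoc }
            ; identity = comm∧idˡ⇒id +-comm +-idˡ }
          ; inverse = comm∧invʳ⇒inv +-comm +-invʳ
          ; ⁻¹-cong = cong -_ }
        ; comm = +-comm }
      ; *-cong = cong₂ _*_
      ; *-assoc = *-assoc
      ; *-identity = comm∧idˡ⇒id *-comm *-idˡ
      ; distrib = Model.distribˡ M , comm∧distrˡ⇒distrʳ *-comm (Model.distribˡ M) }
    ; *-comm = *-comm }

  commutativeRing : CommutativeRing _ _
  commutativeRing = record { isCommutativeRing = isCommutativeRing }

  open CommutativeRing commutativeRing public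
    using (_-_; +-identityʳ; *-identityʳ; zeroˡ; zeroʳ; ring; semiring; +-monoid; +-commutativeSemigroup; +-abelianGroup; +-group)
  open RingProperties ring public using (-1*x≈-x)
  open RingWithoutOneProperties (Ring.ringWithoutOne ring) public
    using (-‿distribˡ-*; -‿distribʳ-*)
  open GroupProperties +-group public using (ε⁻¹≈ε; ⁻¹-involutive)
  open AbelianGroupProperties +-abelianGroup public using (⁻¹-∙-comm)
  open CommutativeSemigroupProperties +-commutativeSemigroup public using () renaming (interchange to +-interchange)
  open MonoidMult +-monoid public using (_×_; ×-homo-+)
  open SemiringMult semiring public using (×1-homo-*; ×-assoc-*)
  open SemiringSum semiring public using (sum-syntax; ∑-distrib-+; *-distribˡ-sum; sum-cong-≗; sum-replicate-zero)

  ⟦_⟧ℕ : ℕ → Carrier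
  ⟦ n ⟧ℕ = ⟦ ℤ.+ n ⟧ℤ

  natMul≡× : ∀ n x → natMul _+_ 0# n x ≡ n × x
  natMul≡× zero    x = refl
  natMul≡× (suc n) x = cong (x +_) (natMul≡× n x)

  natMul-scale : ∀ n x → natMul _+_ 0# n x ≡ ⟦ n ⟧ℕ * x
  natMul-scale n x = begin
    natMul _+_ 0# n x ≡⟨ natMul≡× n x ⟩
    n × x             ≡⟨ cong (n ×_) (sym (*-idˡ x)) ⟩
    n × (1# * x)      ≡⟨ sym (×-assoc-* n 1# x) ⟩
    (n × 1#) * x      ≡⟨ cong (_* x) (sym (natMul≡× n 1#)) ⟩
    ⟦ n ⟧ℕ * x        ∎

  ⟦⟧ℕ-homo-+ : ∀ m n → ⟦ m ℕ.+ n ⟧ℕ ≡ ⟦ m ⟧ℕ + ⟦ n ⟧ℕ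
  ⟦⟧ℕ-homo-+ m n = begin
    ⟦ m ℕ.+ n ⟧ℕ        ≡⟨ natMul≡× (m ℕ.+ n) 1# ⟩
    (m ℕ.+ n) × 1#      ≡⟨ ×-homo-+ 1# m n ⟩
    m × 1# + n × 1#     ≡⟨ sym (cong₂ _+_ (natMul≡× m 1#) (natMul≡× n 1#)) ⟩
    ⟦ m ⟧ℕ + ⟦ n ⟧ℕ     ∎

  ⟦⟧ℕ-homo-* : ∀ m n → ⟦ m ℕ.* n ⟧ℕ ≡ ⟦ m ⟧ℕ * ⟦ n ⟧ℕ
  ⟦⟧ℕ-homo-* m n = begin
    ⟦ m ℕ.* n ⟧ℕ        ≡⟨ natMul≡× (m ℕ.* n) 1# ⟩
    (m ℕ.* n) × 1#      ≡⟨ ×1-homo-* m n ⟩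
    (m × 1#) * (n × 1#) ≡⟨ sym (cong₂ _*_ (natMul≡× m 1#) (natMul≡× n 1#)) ⟩
    ⟦ m ⟧ℕ * ⟦ n ⟧ℕ     ∎

  ⟦⟧ℤ-⊖ : ∀ m n → ⟦ m ℤ.⊖ n ⟧ℤ ≡ ⟦ m ⟧ℕ - ⟦ n ⟧ℕ
  ⟦⟧ℤ-⊖ m       zero    = sym (trans (cong (⟦ m ⟧ℕ +_) ε⁻¹≈ε) (+-identityʳ _))
  ⟦⟧ℤ-⊖ zero    (suc n) = sym (+-idˡ _)
  ⟦⟧ℤ-⊖ (suc m) (suc n) = begin
    ⟦ suc m ℤ.⊖ suc n ⟧ℤ              ≡⟨ cong ⟦_⟧ℤ (ℤ.[1+m]⊖[1+n]≡m⊖n m n) ⟩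
    ⟦ m ℤ.⊖ n ⟧ℤ                      ≡⟨ ⟦⟧ℤ-⊖ m n ⟩
    ⟦ m ⟧ℕ - ⟦ n ⟧ℕ                   ≡⟨ sym (+-idˡ _) ⟩
    0# + (⟦ m ⟧ℕ - ⟦ n ⟧ℕ)            ≡⟨ cong (_+ (⟦ m ⟧ℕ - ⟦ n ⟧ℕ)) (sym (+-invʳ 1#)) ⟩
    (1# - 1#) + (⟦ m ⟧ℕ - ⟦ n ⟧ℕ)     ≡⟨ +-interchange 1# (- 1#) ⟦ m ⟧ℕ (- ⟦ n ⟧ℕ) ⟩
    (1# + ⟦ m ⟧ℕ) + (- 1# - ⟦ n ⟧ℕ)   ≡⟨ cong ((1# + ⟦ m ⟧ℕ) +_) (⁻¹-∙-comm 1# ⟦ n ⟧ℕ) ⟩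
    (1# + ⟦ m ⟧ℕ) - (1# + ⟦ n ⟧ℕ)     ∎

  ⟦⟧ℤ-homo-+ : ∀ i j → ⟦ i ℤ.+ j ⟧ℤ ≡ ⟦ i ⟧ℤ + ⟦ j ⟧ℤ
  ⟦⟧ℤ-homo-+ (ℤ.+ m)  (ℤ.+ n)  = ⟦⟧ℕ-homo-+ m n
  ⟦⟧ℤ-homo-+ (ℤ.+ m)  -[1+ n ] = ⟦⟧ℤ-⊖ m (suc n)
  ⟦⟧ℤ-homo-+ -[1+ m ] (ℤ.+ n)  = trans (⟦⟧ℤ-⊖ n (suc m)) (+-comm _ _)
  ⟦⟧ℤ-homo-+ -[1+ m ] -[1+ n ] = begin
    - ⟦ suc (suc (m ℕ.+ n)) ⟧ℕ      ≡⟨ cong (-_ ∘ ⟦_⟧ℕ ∘ suc) (sym (ℕ.+-suc m n)) ⟩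
    - ⟦ suc m ℕ.+ suc n ⟧ℕ          ≡⟨ cong -_ (⟦⟧ℕ-homo-+ (suc m) (suc n)) ⟩
    - (⟦ suc m ⟧ℕ + ⟦ suc n ⟧ℕ)     ≡⟨ sym (⁻¹-∙-comm _ _) ⟩
    - ⟦ suc m ⟧ℕ - ⟦ suc n ⟧ℕ       ∎

  ⟦⟧ℤ-homo-neg : ∀ i → ⟦ ℤ.- i ⟧ℤ ≡ - ⟦ i ⟧ℤ
  ⟦⟧ℤ-homo-neg (ℤ.+ zero)    = sym ε⁻¹≈ε
  ⟦⟧ℤ-homo-neg (ℤ.+ (suc n)) = refl
  ⟦⟧ℤ-homo-neg -[1+ n ]      = sym (⁻¹-involutive _)

  signed : Sign → Carrier → Carrier
  signed Sign.+ x = x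
  signed Sign.- x = - x

  ⟦◃⟧ℤ : ∀ s n → ⟦ s ℤ.◃ n ⟧ℤ ≡ signed s ⟦ n ⟧ℕ
  ⟦◃⟧ℤ Sign.+ zero    = refl
  ⟦◃⟧ℤ Sign.- zero    = sym ε⁻¹≈ε
  ⟦◃⟧ℤ Sign.+ (suc n) = refl
  ⟦◃⟧ℤ Sign.- (suc n) = refl

  signed-* : ∀ s t x y → signed s x * signed t y ≡ signed (s Sign.* t) (x * y)
  signed-* Sign.+ Sign.+ x y = refl
  signed-* Sign.+ Sign.- x y = sym (-‿distribʳ-* x y)
  signed-* Sign.- Sign.+ x y = sym (-‿distribˡ-* x y)
  signed-* Sign.- Sign.- x y = begin
    - x * - y     ≡⟨ sym (-‿distribˡ-* x (- y)) ⟩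
    - (x * - y)   ≡⟨ cong -_ (sym (-‿distribʳ-* x y)) ⟩
    - - (x * y)   ≡⟨ ⁻¹-involutive _ ⟩
    x * y         ∎

  ⟦⟧ℤ-signed : ∀ i → ⟦ i ⟧ℤ ≡ signed (ℤ.sign i) ⟦ ℤ.∣ i ∣ ⟧ℕ
  ⟦⟧ℤ-signed i = trans (cong ⟦_⟧ℤ (sym (ℤ.◃-inverse i))) (⟦◃⟧ℤ (ℤ.sign i) ℤ.∣ i ∣)

  ⟦⟧ℤ-homo-* : ∀ i j → ⟦ i ℤ.* j ⟧ℤ ≡ ⟦ i ⟧ℤ * ⟦ j ⟧ℤ
  ⟦⟧ℤ-homo-* i j = begin
    ⟦ i ℤ.* j ⟧ℤ                                   ≡⟨ ⟦◃⟧ℤ (s Sign.* t) (ℤ.∣ i ∣ ℕ.* ℤ.∣ j ∣) ⟩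
    signed (s Sign.* t) ⟦ ℤ.∣ i ∣ ℕ.* ℤ.∣ j ∣ ⟧ℕ    ≡⟨ cong (signed (s Sign.* t)) (⟦⟧ℕ-homo-* ℤ.∣ i ∣ ℤ.∣ j ∣) ⟩
    signed (s Sign.* t) (⟦ ℤ.∣ i ∣ ⟧ℕ * ⟦ ℤ.∣ j ∣ ⟧ℕ) ≡⟨ sym (signed-* s t _ _) ⟩
    signed s ⟦ ℤ.∣ i ∣ ⟧ℕ * signed t ⟦ ℤ.∣ j ∣ ⟧ℕ    ≡⟨ sym (cong₂ _*_ (⟦⟧ℤ-signed i) (⟦⟧ℤ-signed j)) ⟩
    ⟦ i ⟧ℤ * ⟦ j ⟧ℤ                                ∎
    where
    s t : Sign
    s = ℤ.sign i
    t = ℤ.sign j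

  ⟦⟧ℤ-morphism : ℤ.+-*-rawRing ACR.-Raw-AlmostCommutative⟶ ACR.fromCommutativeRing commutativeRing
  ⟦⟧ℤ-morphism = record
    { ⟦_⟧ = ⟦_⟧ℤ ; +-homo = ⟦⟧ℤ-homo-+ ; *-homo = ⟦⟧ℤ-homo-* ; -‿homo = ⟦⟧ℤ-homo-neg
    ; 0-homo = refl ; 1-homo = +-identityʳ 1# }

  open import Algebra.Solver.Ring ℤ.+-*-rawRing (ACR.fromCommutativeRing commutativeRing) ⟦⟧ℤ-morphism
    (λ i j → Maybe.map (cong ⟦_⟧ℤ) (dec⇒weaklyDec ℤ._≟_ i j)) public
    using (solve; _:=_; _:+_; _:*_; _:-_)

  -- reciprocal d is 1/(d+1), matching the "denominator minus one" field of ℚ and ℚᵘ.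
  reciprocal : ℕ → Carrier
  reciprocal d = proj₁ (divisible d)

  *-reciprocal : ∀ d → ⟦ suc d ⟧ℕ * reciprocal d ≡ 1#
  *-reciprocal d = trans (sym (natMul-scale (suc d) _)) (proj₂ (divisible d))

  reciprocal-unique : ∀ d x → ⟦ suc d ⟧ℕ * x ≡ 1# → x ≡ reciprocal d
  reciprocal-unique d x e = begin
    x                                   ≡⟨ sym (*-idˡ x) ⟩
    1# * x                              ≡⟨ cong (_* x) (sym (*-reciprocal d)) ⟩
    ⟦ suc d ⟧ℕ * reciprocal d * x       ≡⟨ solve 3 (λ a b c → a :* b :* c := b :* (a :* c)) refl ⟦ suc d ⟧ℕ (reciprocal d) x ⟩
    reciprocal d * (⟦ suc d ⟧ℕ * x)     ≡⟨ cong (reciprocal d *_) e ⟩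
    reciprocal d * 1#                   ≡⟨ *-identityʳ _ ⟩
    reciprocal d                        ∎

  reciprocal-0 : reciprocal 0 ≡ 1#
  reciprocal-0 = sym (reciprocal-unique 0 1# (trans (*-identityʳ _) (+-identityʳ 1#)))

  reciprocal-* : ∀ d e → reciprocal (ℕ.pred (suc d ℕ.* suc e)) ≡ reciprocal d * reciprocal e
  reciprocal-* d e = sym (reciprocal-unique _ _ (begin
    ⟦ suc d ℕ.* suc e ⟧ℕ * (reciprocal d * reciprocal e)
      ≡⟨ cong (_* (reciprocal d * reciprocal e)) (⟦⟧ℕ-homo-* (suc d) (suc e)) ⟩
    ⟦ suc d ⟧ℕ * ⟦ suc e ⟧ℕ * (reciprocal d * reciprocal e)
      ≡⟨ solve 4 (λ a b c d → a :* b :* (c :* d) := a :* c :* (b :* d)) refl _ _ _ _ ⟩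
    ⟦ suc d ⟧ℕ * reciprocal d * (⟦ suc e ⟧ℕ * reciprocal e)
      ≡⟨ cong₂ _*_ (*-reciprocal d) (*-reciprocal e) ⟩
    1# * 1#
      ≡⟨ *-identityʳ 1# ⟩
    1# ∎))

  ⟦_⟧ᵘ : ℚᵘ.ℚᵘ → Carrier
  ⟦ ℚᵘ.mkℚᵘ n d ⟧ᵘ = ⟦ n ⟧ℤ * reciprocal d

  cancel-denominator : ∀ n d e → ⟦ n ℤ.* ℤ.+ suc e ⟧ℤ * (reciprocal d * reciprocal e) ≡ ⟦ n ⟧ℤ * reciprocal d
  cancel-denominator n d e = begin
    ⟦ n ℤ.* ℤ.+ suc e ⟧ℤ * (reciprocal d * reciprocal e)
      ≡⟨ cong (_* (reciprocal d * reciprocal e)) (⟦⟧ℤ-homo-* n (ℤ.+ suc e)) ⟩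
    ⟦ n ⟧ℤ * ⟦ suc e ⟧ℕ * (reciprocal d * reciprocal e)
      ≡⟨ solve 4 (λ a b c d → a :* b :* (c :* d) := a :* c :* (b :* d)) refl _ _ _ _ ⟩
    ⟦ n ⟧ℤ * reciprocal d * (⟦ suc e ⟧ℕ * reciprocal e)
      ≡⟨ cong (⟦ n ⟧ℤ * reciprocal d *_) (*-reciprocal e) ⟩
    ⟦ n ⟧ℤ * reciprocal d * 1#
      ≡⟨ *-identityʳ _ ⟩
    ⟦ n ⟧ℤ * reciprocal d ∎

  ⟦⟧ᵘ-cong : ∀ p q → p ℚᵘ.≃ q → ⟦ p ⟧ᵘ ≡ ⟦ q ⟧ᵘ
  ⟦⟧ᵘ-cong (ℚᵘ.mkℚᵘ n d) (ℚᵘ.mkℚᵘ n' d') (ℚᵘ.*≡* e) = begin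
    ⟦ n ⟧ℤ * reciprocal d                                   ≡⟨ sym (cancel-denominator n d d') ⟩
    ⟦ n ℤ.* ℤ.+ suc d' ⟧ℤ * (reciprocal d * reciprocal d')  ≡⟨ cong₂ (λ i r → ⟦ i ⟧ℤ * r) e (*-comm _ _) ⟩
    ⟦ n' ℤ.* ℤ.+ suc d ⟧ℤ * (reciprocal d' * reciprocal d)  ≡⟨ cancel-denominator n' d' d ⟩
    ⟦ n' ⟧ℤ * reciprocal d'                                 ∎

  ⟦⟧ᵘ-homo-+ : ∀ p q → ⟦ p ℚᵘ.+ q ⟧ᵘ ≡ ⟦ p ⟧ᵘ + ⟦ q ⟧ᵘ
  ⟦⟧ᵘ-homo-+ (ℚᵘ.mkℚᵘ n d) (ℚᵘ.mkℚᵘ n' d') = begin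
    ⟦ n ℤ.* ℤ.+ suc d' ℤ.+ n' ℤ.* ℤ.+ suc d ⟧ℤ * reciprocal (ℕ.pred (suc d ℕ.* suc d'))
      ≡⟨ cong₂ _*_ (⟦⟧ℤ-homo-+ (n ℤ.* ℤ.+ suc d') (n' ℤ.* ℤ.+ suc d)) (reciprocal-* d d') ⟩
    (⟦ n ℤ.* ℤ.+ suc d' ⟧ℤ + ⟦ n' ℤ.* ℤ.+ suc d ⟧ℤ) * (reciprocal d * reciprocal d')
      ≡⟨ solve 4 (λ a b c d → (a :+ b) :* (c :* d) := a :* (c :* d) :+ b :* (d :* c)) refl _ _ _ _ ⟩
    ⟦ n ℤ.* ℤ.+ suc d' ⟧ℤ * (reciprocal d * reciprocal d') + ⟦ n' ℤ.* ℤ.+ suc d ⟧ℤ * (reciprocal d' * reciprocal d)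
      ≡⟨ cong₂ _+_ (cancel-denominator n d d') (cancel-denominator n' d' d) ⟩
    ⟦ n ⟧ℤ * reciprocal d + ⟦ n' ⟧ℤ * reciprocal d' ∎

  ⟦⟧ᵘ-homo-* : ∀ p q → ⟦ p ℚᵘ.* q ⟧ᵘ ≡ ⟦ p ⟧ᵘ * ⟦ q ⟧ᵘ
  ⟦⟧ᵘ-homo-* (ℚᵘ.mkℚᵘ n d) (ℚᵘ.mkℚᵘ n' d') = begin
    ⟦ n ℤ.* n' ⟧ℤ * reciprocal (ℕ.pred (suc d ℕ.* suc d'))  ≡⟨ cong₂ _*_ (⟦⟧ℤ-homo-* n n') (reciprocal-* d d') ⟩
    ⟦ n ⟧ℤ * ⟦ n' ⟧ℤ * (reciprocal d * reciprocal d')      ≡⟨ solve 4 (λ a b c d → a :* b :* (c :* d) := a :* c :* (b :* d)) refl _ _ _ _ ⟩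
    ⟦ n ⟧ℤ * reciprocal d * (⟦ n' ⟧ℤ * reciprocal d')      ∎

  ⟦⟧ℚ≡⟦toℚᵘ⟧ : ∀ p → ⟦ p ⟧ℚ ≡ ⟦ ℚ.toℚᵘ p ⟧ᵘ
  ⟦⟧ℚ≡⟦toℚᵘ⟧ (ℚ.mkℚ n d _) = refl

  ⟦⟧ℚ-homo-+ : ∀ p q → ⟦ p ℚ.+ q ⟧ℚ ≡ ⟦ p ⟧ℚ + ⟦ q ⟧ℚ
  ⟦⟧ℚ-homo-+ p q = begin
    ⟦ p ℚ.+ q ⟧ℚ                        ≡⟨ ⟦⟧ℚ≡⟦toℚᵘ⟧ (p ℚ.+ q) ⟩
    ⟦ ℚ.toℚᵘ (p ℚ.+ q) ⟧ᵘ               ≡⟨ ⟦⟧ᵘ-cong _ _ (ℚ.toℚᵘ-homo-+ p q) ⟩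
    ⟦ ℚ.toℚᵘ p ℚᵘ.+ ℚ.toℚᵘ q ⟧ᵘ         ≡⟨ ⟦⟧ᵘ-homo-+ (ℚ.toℚᵘ p) (ℚ.toℚᵘ q) ⟩
    ⟦ ℚ.toℚᵘ p ⟧ᵘ + ⟦ ℚ.toℚᵘ q ⟧ᵘ       ≡⟨ sym (cong₂ _+_ (⟦⟧ℚ≡⟦toℚᵘ⟧ p) (⟦⟧ℚ≡⟦toℚᵘ⟧ q)) ⟩
    ⟦ p ⟧ℚ + ⟦ q ⟧ℚ                     ∎

  ⟦⟧ℚ-homo-* : ∀ p q → ⟦ p ℚ.* q ⟧ℚ ≡ ⟦ p ⟧ℚ * ⟦ q ⟧ℚ
  ⟦⟧ℚ-homo-* p q = begin
    ⟦ p ℚ.* q ⟧ℚ                        ≡⟨ ⟦⟧ℚ≡⟦toℚᵘ⟧ (p ℚ.* q) ⟩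
    ⟦ ℚ.toℚᵘ (p ℚ.* q) ⟧ᵘ               ≡⟨ ⟦⟧ᵘ-cong _ _ (ℚ.toℚᵘ-homo-* p q) ⟩
    ⟦ ℚ.toℚᵘ p ℚᵘ.* ℚ.toℚᵘ q ⟧ᵘ         ≡⟨ ⟦⟧ᵘ-homo-* (ℚ.toℚᵘ p) (ℚ.toℚᵘ q) ⟩
    ⟦ ℚ.toℚᵘ p ⟧ᵘ * ⟦ ℚ.toℚᵘ q ⟧ᵘ       ≡⟨ sym (cong₂ _*_ (⟦⟧ℚ≡⟦toℚᵘ⟧ p) (⟦⟧ℚ≡⟦toℚᵘ⟧ q)) ⟩
    ⟦ p ⟧ℚ * ⟦ q ⟧ℚ                     ∎

  ⟦0⟧ℚ : ⟦ 0ℚ ⟧ℚ ≡ 0#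
  ⟦0⟧ℚ = zeroˡ _

  ⟦1⟧ℚ : ⟦ 1ℚ ⟧ℚ ≡ 1#
  ⟦1⟧ℚ = trans (cong₂ _*_ (+-identityʳ 1#) reciprocal-0) (*-identityʳ 1#)

  ⟦-1⟧ℚ : ⟦ ℚ.- 1ℚ ⟧ℚ ≡ - 1#
  ⟦-1⟧ℚ = trans (cong₂ _*_ (cong -_ (+-identityʳ 1#)) reciprocal-0) (*-identityʳ _)

  +-nonneg : ∀ {x y} → 0# ≤ x → 0# ≤ y → 0# ≤ x + y
  +-nonneg {x} {y} 0≤x 0≤y = ≤-trans 0# y (x + y) 0≤y (subst₂ _≤_ (+-idˡ y) refl (≤-+ 0# x y 0≤x))

  natMul-nonneg : ∀ n {x} → 0# ≤ x → 0# ≤ natMul _+_ 0# n x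
  natMul-nonneg zero    0≤x = ≤-refl 0#
  natMul-nonneg (suc n) 0≤x = +-nonneg 0≤x (natMul-nonneg n 0≤x)

  ⟦⟧ℚ-*-nonneg : ∀ c {x} → 0ℚ ℚ.≤ c → 0# ≤ x → 0# ≤ ⟦ c ⟧ℚ * x
  ⟦⟧ℚ-*-nonneg (ℚ.mkℚ (ℤ.+ j) d _) {x} _ 0≤x =
    subst₂ _≤_ refl (trans (natMul-scale j _) (sym (*-assoc _ _ _))) (natMul-nonneg j 0≤x/d)
    where
    0≤x/d : 0# ≤ reciprocal d * x
    0≤x/d = ≤-cancel d _ (subst₂ _≤_ refl (sym (begin
      natMul _+_ 0# (suc d) (reciprocal d * x)  ≡⟨ natMul-scale (suc d) _ ⟩
      ⟦ suc d ⟧ℕ * (reciprocal d * x)           ≡⟨ sym (*-assoc _ _ _) ⟩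
      ⟦ suc d ⟧ℕ * reciprocal d * x             ≡⟨ cong (_* x) (*-reciprocal d) ⟩
      1# * x                                    ≡⟨ *-idˡ x ⟩
      x                                         ∎)) 0≤x)
  ⟦⟧ℚ-*-nonneg (ℚ.mkℚ -[1+ j ] d _) 0≤c _ = ⊥-elim (ℤ.NonNegative.nonNeg (ℚ.nonNegative 0≤c))

  x≤y⇒0≤y-x : ∀ {x y} → x ≤ y → 0# ≤ y - x
  x≤y⇒0≤y-x {x} {y} x≤y = subst₂ _≤_ (+-invʳ x) refl (≤-+ x y (- x) x≤y)

  0≤y-x⇒x≤y : ∀ {x y} → 0# ≤ y - x → x ≤ y
  0≤y-x⇒x≤y {x} {y} 0≤y-x = subst₂ _≤_ (+-idˡ x) (solve 2 (λ x y → y :- x :+ x := y) refl x y) (≤-+ 0# (y - x) x 0≤y-x)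

  evalP-cong : ∀ {S} (ρ : S → Carrier) {p q : Poly S} → p ≈ₚ q → evalP M ρ p ≡ evalP M ρ q
  evalP-cong ρ ≈-refl              = refl
  evalP-cong ρ (≈-sym p≈q)         = sym (evalP-cong ρ p≈q)
  evalP-cong ρ (≈-trans p≈q q≈r)   = trans (evalP-cong ρ p≈q) (evalP-cong ρ q≈r)
  evalP-cong ρ (⊕-cong p≈p' q≈q')  = cong₂ _+_ (evalP-cong ρ p≈p') (evalP-cong ρ q≈q')
  evalP-cong ρ (⊗-cong p≈p' q≈q')  = cong₂ _*_ (evalP-cong ρ p≈p') (evalP-cong ρ q≈q')
  evalP-cong ρ (⊕-assoc p q r)     = +-assoc _ _ _
  evalP-cong ρ (⊕-comm p q)        = +-comm _ _
  evalP-cong ρ (⊕-idˡ p)           = trans (cong (_+ evalP M ρ p) ⟦0⟧ℚ) (+-idˡ _)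
  evalP-cong ρ (⊕-invʳ p)          =
    trans (cong (evalP M ρ p +_) (trans (cong (_* evalP M ρ p) ⟦-1⟧ℚ) (-1*x≈-x _))) (trans (+-invʳ _) (sym ⟦0⟧ℚ))
  evalP-cong ρ (⊗-assoc p q r)     = *-assoc _ _ _
  evalP-cong ρ (⊗-comm p q)        = *-comm _ _
  evalP-cong ρ (⊗-idˡ p)           = trans (cong (_* evalP M ρ p) ⟦1⟧ℚ) (*-idˡ _)
  evalP-cong ρ (distribˡ p q r)    = Model.distribˡ M _ _ _
  evalP-cong ρ (con-+ a b)         = ⟦⟧ℚ-homo-+ a b
  evalP-cong ρ (con-* a b)         = ⟦⟧ℚ-homo-* a b

  evalP-ext : ∀ {S} {ρ ρ' : S → Carrier} → (∀ x → ρ x ≡ ρ' x) → ∀ p → evalP M ρ p ≡ evalP M ρ' p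
  evalP-ext ρ≗ρ' (var x) = ρ≗ρ' x
  evalP-ext ρ≗ρ' (con c) = refl
  evalP-ext ρ≗ρ' (p ⊕ q) = cong₂ _+_ (evalP-ext ρ≗ρ' p) (evalP-ext ρ≗ρ' q)
  evalP-ext ρ≗ρ' (p ⊗ q) = cong₂ _*_ (evalP-ext ρ≗ρ' p) (evalP-ext ρ≗ρ' q)

  evalP-subst : ∀ {S T} (ρ : T → Carrier) (σ : S → Poly T) p →
                evalP M ρ (subst σ p) ≡ evalP M (evalP M ρ ∘ σ) p
  evalP-subst ρ σ (var x) = refl
  evalP-subst ρ σ (con c) = refl
  evalP-subst ρ σ (p ⊕ q) = cong₂ _+_ (evalP-subst ρ σ p) (evalP-subst ρ σ q)
  evalP-subst ρ σ (p ⊗ q) = cong₂ _*_ (evalP-subst ρ σ p) (evalP-subst ρ σ q)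

  evalP-ren : ∀ {S T} (ρ : T → Carrier) (f : S → T) p → evalP M ρ (ren f p) ≡ evalP M (ρ ∘ f) p
  evalP-ren ρ f = evalP-subst ρ (var ∘ f)

  evalP-sumP : ∀ {S k} (ρ : S → Carrier) (f : Fin k → Poly S) → evalP M ρ (sumP f) ≡ ∑[ i < k ] evalP M ρ (f i)
  evalP-sumP {k = zero}  ρ f = ⟦0⟧ℚ
  evalP-sumP {k = suc k} ρ f = cong (evalP M ρ (f zero) +_) (evalP-sumP ρ (f ∘ suc))

  evalP-lin : ∀ {m} (ρ : Fin m → Carrier) (c : LinForm m) → evalP M ρ (lin c) ≡ ∑[ i < m ] (⟦ c i ⟧ℚ * ρ i)
  evalP-lin ρ c = evalP-sumP ρ (λ i → con (c i) ⊗ var i)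

  ∑-0# : ∀ n (f : Fin n → Carrier) → (∀ i → f i ≡ 0#) → ∑[ i < n ] f i ≡ 0#
  ∑-0# n f f≗0 = trans (sum-cong-≗ {n} {f} {λ _ → 0#} f≗0) (sum-replicate-zero n)

  evalP-lin-0# : ∀ {m} (c : LinForm m) → evalP M (λ _ → 0#) (lin c) ≡ 0#
  evalP-lin-0# {m} c = trans (evalP-lin _ c) (∑-0# m _ (λ i → zeroʳ _))

  evalP-lin-zeroLin : ∀ {m} (ρ : Fin m → Carrier) → evalP M ρ (lin zeroLin) ≡ 0#
  evalP-lin-zeroLin {m} ρ = trans (evalP-lin ρ zeroLin) (∑-0# m _ (λ i → trans (cong (_* ρ i) ⟦0⟧ℚ) (zeroˡ _)))

  evalP-δ-lin : ∀ {m} (σ : Sym m → Carrier) (c : LinForm m) →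
                evalP M σ (δ (lin c)) ≡ evalP M σ (unp (lin c)) - evalP M σ ((lin c) ′)
  evalP-δ-lin {m} σ c = begin
    evalP M σ (δ (lin c))
      ≡⟨ evalP-subst σ _ (lin c) ⟩
    evalP M (λ x → σ (inj₁ x) + ⟦ ℚ.- 1ℚ ⟧ℚ * σ (inj₂ x)) (lin c)
      ≡⟨ evalP-lin _ c ⟩
    ∑[ i < m ] (⟦ c i ⟧ℚ * (σ (inj₁ i) + ⟦ ℚ.- 1ℚ ⟧ℚ * σ (inj₂ i)))
      ≡⟨ sum-cong-≗ (λ i → trans (cong (λ u → ⟦ c i ⟧ℚ * (σ (inj₁ i) + u * σ (inj₂ i))) ⟦-1⟧ℚ)
           (solve 4 (λ a x m y → a :* (x :+ m :* y) := a :* x :+ m :* (a :* y)) refl _ _ (- 1#) _)) ⟩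
    ∑[ i < m ] (⟦ c i ⟧ℚ * σ (inj₁ i) + - 1# * (⟦ c i ⟧ℚ * σ (inj₂ i)))
      ≡⟨ ∑-distrib-+ (λ i → ⟦ c i ⟧ℚ * σ (inj₁ i)) (λ i → - 1# * (⟦ c i ⟧ℚ * σ (inj₂ i))) ⟩
    ∑[ i < m ] (⟦ c i ⟧ℚ * σ (inj₁ i)) + ∑[ i < m ] (- 1# * (⟦ c i ⟧ℚ * σ (inj₂ i)))
      ≡⟨ cong (∑[ i < m ] (⟦ c i ⟧ℚ * σ (inj₁ i)) +_) (sym (*-distribˡ-sum (- 1#) (λ i → ⟦ c i ⟧ℚ * σ (inj₂ i)))) ⟩
    ∑[ i < m ] (⟦ c i ⟧ℚ * σ (inj₁ i)) + - 1# * ∑[ i < m ] (⟦ c i ⟧ℚ * σ (inj₂ i))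
      ≡⟨ cong₂ _+_ (sym (evalP-lin (σ ∘ inj₁) c)) (trans (-1*x≈-x _) (cong -_ (sym (evalP-lin (σ ∘ inj₂) c)))) ⟩
    evalP M (σ ∘ inj₁) (lin c) - evalP M (σ ∘ inj₂) (lin c)
      ≡⟨ sym (cong₂ _-_ (evalP-ren σ inj₁ (lin c)) (evalP-ren σ inj₂ (lin c))) ⟩
    evalP M σ (unp (lin c)) - evalP M σ ((lin c) ′) ∎

  ⋀-elim : ∀ {T k} (ev : T → Carrier) (f : Fin k → Fml T) → Sat M ev (⋀ f) → ∀ i → Sat M ev (f i)
  ⋀-elim ev f (ev⊨f0 , _)  zero    = ev⊨f0
  ⋀-elim ev f (_ , ev⊨fs) (suc i) = ⋀-elim ev (f ∘ suc) ev⊨fs i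

module Valuations (M : Model) {m n : ℕ} (a : Fin n → LinForm m) (σ : Sym m → Model.Carrier M) where
  open Model M
  open ModelProperties M

  ⟦a⟧ : Fin n → Carrier
  ⟦a⟧ i = evalP M σ (unp (lin (a i)))

  d↦δ : Fin m ⊎ Fin n → Carrier
  d↦δ = evalP M σ ∘ [ (λ x → δ (var x)) , (λ i → unp (lin (a i))) ]

  d↦0 : Fin m ⊎ Fin n → Carrier
  d↦0 = [ (λ _ → 0#) , ⟦a⟧ ]

  evalP-δinv : ∀ p → evalP M σ (δinv a p) ≡ evalP M d↦δ p
  evalP-δinv = evalP-subst σ _

  evalP-unp-inv : ∀ q → evalP M σ (unp (inv a q)) ≡ evalP M ⟦a⟧ q
  evalP-unp-inv q = begin
    evalP M σ (unp (inv a q))                         ≡⟨ evalP-ren σ inj₁ (inv a q) ⟩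
    evalP M (σ ∘ inj₁) (inv a q)                      ≡⟨ evalP-subst (σ ∘ inj₁) (lin ∘ a) q ⟩
    evalP M (λ i → evalP M (σ ∘ inj₁) (lin (a i))) q  ≡⟨ evalP-ext (λ i → sym (evalP-ren σ inj₁ (lin (a i)))) q ⟩
    evalP M ⟦a⟧ q                                     ∎

  evalP-unp-≈inv : ∀ p q → p ≈ₚ inv a q → evalP M σ (unp p) ≡ evalP M ⟦a⟧ q
  evalP-unp-≈inv p q p≈inv = begin
    evalP M σ (unp p)             ≡⟨ evalP-ren σ inj₁ p ⟩
    evalP M (σ ∘ inj₁) p          ≡⟨ evalP-cong (σ ∘ inj₁) p≈inv ⟩
    evalP M (σ ∘ inj₁) (inv a q)  ≡⟨ sym (evalP-ren σ inj₁ (inv a q)) ⟩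
    evalP M σ (unp (inv a q))     ≡⟨ evalP-unp-inv q ⟩
    evalP M ⟦a⟧ q                 ∎

  evalP-d↦δ-embedDK : ∀ c q → evalP M d↦δ (embedDK (c , q)) ≡ evalP M σ (δ (lin c)) + evalP M ⟦a⟧ q
  evalP-d↦δ-embedDK c q = cong₂ _+_
    (trans (evalP-ren d↦δ inj₁ (lin c)) (sym (evalP-subst σ _ (lin c))))
    (evalP-ren d↦δ inj₂ q)

  evalP-d↦0-embedDK : ∀ c q → evalP M d↦0 (embedDK (c , q)) ≡ evalP M ⟦a⟧ q
  evalP-d↦0-embedDK c q = trans
    (cong₂ _+_ (trans (evalP-ren d↦0 inj₁ (lin c)) (evalP-lin-0# c)) (evalP-ren d↦0 inj₂ q))
    (+-idˡ _)

rec⇒Cn : ∀ {m n} (F : TransFormula m) (a : Fin n → LinForm m) (r : LinForm m) (p : Poly (Fin m)) (q : Poly (Fin n)) →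
         p ≈ₚ inv a q → F ⊨ᵀ ((lin r) ′ ≤ᶠ unp (lin r) ⊕ unp p) → Cn F (δinv a (embedDK (r , q)))
rec⇒Cn F a r p q p≈inv F⊨r′≤r+p M σ σ⊨F = subst₂ _≤_ (sym ⟦0⟧ℚ) (sym (begin
    evalP M σ (δinv a (embedDK (r , q)))     ≡⟨ evalP-δinv (embedDK (r , q)) ⟩
    evalP M d↦δ (embedDK (r , q))            ≡⟨ evalP-d↦δ-embedDK r q ⟩
    evalP M σ (δ (lin r)) + ⟦q⟧              ≡⟨ cong (_+ ⟦q⟧) (evalP-δ-lin σ r) ⟩
    (⟦r⟧ - ⟦r′⟧) + ⟦q⟧                       ≡⟨ solve 3 (λ x y z → x :- y :+ z := x :+ z :- y) refl ⟦r⟧ ⟦r′⟧ ⟦q⟧ ⟩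
    (⟦r⟧ + ⟦q⟧) - ⟦r′⟧                       ≡⟨ cong (λ u → (⟦r⟧ + u) - ⟦r′⟧) (sym (evalP-unp-≈inv p q p≈inv)) ⟩
    (⟦r⟧ + evalP M σ (unp p)) - ⟦r′⟧         ∎))
  (x≤y⇒0≤y-x (F⊨r′≤r+p M σ σ⊨F))
  where
  open Model M
  open ModelProperties M
  open Valuations M a σ
  ⟦r⟧ ⟦r′⟧ ⟦q⟧ : Carrier
  ⟦r⟧  = evalP M σ (unp (lin r))
  ⟦r′⟧ = evalP M σ ((lin r) ′)
  ⟦q⟧  = evalP M ⟦a⟧ q

module CfExtension (M : Model) {m n : ℕ} (a : Fin n → LinForm m) (ρ : SymT m → Model.Carrier M) where
  open Model M
  open ModelProperties M
  open Valuations M a (ρ ∘ inj₁)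

  σ : Sym m → Carrier
  σ = ρ ∘ inj₁

  t : Carrier
  t = ρ (inj₂ tt)

  Φ : Poly (Fin m ⊎ Fin n) → Carrier
  Φ p = (evalP M d↦δ p - evalP M d↦0 p) + t * evalP M d↦0 p

  Φ-cong : ∀ {p q} → p ≈ₚ q → Φ p ≡ Φ q
  Φ-cong p≈q = cong₂ (λ x y → (x - y) + t * y) (evalP-cong d↦δ p≈q) (evalP-cong d↦0 p≈q)

  Φ-⊕ : ∀ p q → Φ (p ⊕ q) ≡ Φ p + Φ q
  Φ-⊕ p q = solve 5 (λ t x x₀ y y₀ → (x :+ y :- (x₀ :+ y₀)) :+ t :* (x₀ :+ y₀) := ((x :- x₀) :+ t :* x₀) :+ ((y :- y₀) :+ t :* y₀))
    refl t (evalP M d↦δ p) (evalP M d↦0 p) (evalP M d↦δ q) (evalP M d↦0 q)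

  Φ-scale : ∀ c p → Φ (con c ⊗ p) ≡ ⟦ c ⟧ℚ * Φ p
  Φ-scale c p = solve 4 (λ t k x x₀ → (k :* x :- k :* x₀) :+ t :* (k :* x₀) := k :* ((x :- x₀) :+ t :* x₀))
    refl t ⟦ c ⟧ℚ (evalP M d↦δ p) (evalP M d↦0 p)

  Φ-sumP-nonneg : ∀ {k} (f : Fin k → Poly (Fin m ⊎ Fin n)) → (∀ i → 0# ≤ Φ (f i)) → 0# ≤ Φ (sumP f)
  Φ-sumP-nonneg {zero}  f _ = subst₂ _≤_ refl (sym Φ-con0) (≤-refl 0#)
    where
    Φ-con0 : Φ (con 0ℚ) ≡ 0#
    Φ-con0 = trans (cong₂ _+_ (+-invʳ _) (trans (cong (t *_) ⟦0⟧ℚ) (zeroʳ t))) (+-idˡ 0#)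
  Φ-sumP-nonneg {suc k} f 0≤Φf = subst₂ _≤_ refl (sym (Φ-⊕ (f zero) (sumP (f ∘ suc))))
    (+-nonneg (0≤Φf zero) (Φ-sumP-nonneg (f ∘ suc) (0≤Φf ∘ suc)))

  Φ-K-product : ∀ u v → Φ (ren inj₂ u ⊗ ren inj₂ v) ≡ evalP M ⟦a⟧ u * (t * evalP M ⟦a⟧ v)
  Φ-K-product u v = begin
    Φ (ren inj₂ u ⊗ ren inj₂ v)
      ≡⟨ cong₂ (λ x y → (x - y) + t * y)
           (cong₂ _*_ (evalP-ren d↦δ inj₂ u) (evalP-ren d↦δ inj₂ v))
           (cong₂ _*_ (evalP-ren d↦0 inj₂ u) (evalP-ren d↦0 inj₂ v)) ⟩
    (⟦u⟧ * ⟦v⟧ - ⟦u⟧ * ⟦v⟧) + t * (⟦u⟧ * ⟦v⟧)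
      ≡⟨ solve 3 (λ t U V → (U :* V :- U :* V) :+ t :* (U :* V) := U :* (t :* V)) refl t ⟦u⟧ ⟦v⟧ ⟩
    ⟦u⟧ * (t * ⟦v⟧) ∎
    where
    ⟦u⟧ ⟦v⟧ : Carrier
    ⟦u⟧ = evalP M ⟦a⟧ u
    ⟦v⟧ = evalP M ⟦a⟧ v

  evalP-cf : ∀ c q → evalP M ρ (cf a (c , q)) ≡ evalP M σ (δ (lin c)) + t * evalP M ⟦a⟧ q
  evalP-cf c q = cong₂ (λ x y → x + t * y)
    (evalP-ren ρ inj₁ (δ (lin c)))
    (trans (evalP-ren ρ inj₁ (unp (inv a q))) (evalP-unp-inv q))

  Φ-embedDK : ∀ d → Φ (embedDK d) ≡ evalP M ρ (cf a d)
  Φ-embedDK (c , q) = begin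
    Φ (embedDK (c , q))
      ≡⟨ cong₂ (λ x y → (x - y) + t * y) (evalP-d↦δ-embedDK c q) (evalP-d↦0-embedDK c q) ⟩
    (⟦δc⟧ + ⟦q⟧ - ⟦q⟧) + t * ⟦q⟧
      ≡⟨ solve 3 (λ t D Q → (D :+ Q :- Q) :+ t :* Q := D :+ t :* Q) refl t ⟦δc⟧ ⟦q⟧ ⟩
    ⟦δc⟧ + t * ⟦q⟧
      ≡⟨ sym (evalP-cf c q) ⟩
    evalP M ρ (cf a (c , q)) ∎
    where
    ⟦δc⟧ ⟦q⟧ : Carrier
    ⟦δc⟧ = evalP M σ (δ (lin c))
    ⟦q⟧  = evalP M ⟦a⟧ q

  Φ-nonneg-on-cone : ∀ {nv nr} (V : Fin nv → Poly (Fin n)) (R : Fin nr → DK m n) →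
                     Sat M (evalP M ρ) (expF a V R) → ∀ {p} → InModCone V R p → 0# ≤ Φ p
  Φ-nonneg-on-cone V R (ρ⊨V , ρ⊨R) (qs , λs , 0≤λs , p≈) =
    subst₂ _≤_ refl (sym (trans (Φ-cong p≈) (Φ-⊕ (sumP V-summand) (sumP R-summand))))
      (+-nonneg (Φ-sumP-nonneg _ V-term) (Φ-sumP-nonneg _ R-term))
    where
    V-summand : Fin _ → Poly (Fin m ⊎ Fin n)
    V-summand i = ren inj₂ (qs i) ⊗ ren inj₂ (V i)

    R-summand : Fin _ → Poly (Fin m ⊎ Fin n)
    R-summand j = con (λs j) ⊗ embedDK (R j)

    t*V≡0 : ∀ i → t * evalP M ⟦a⟧ (V i) ≡ 0#
    t*V≡0 i = begin
      t * evalP M ⟦a⟧ (V i)                                  ≡⟨ sym (+-idˡ _) ⟩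
      0# + t * evalP M ⟦a⟧ (V i)                             ≡⟨ cong (_+ t * evalP M ⟦a⟧ (V i)) (sym δ0≡0) ⟩
      evalP M σ (δ (lin zeroLin)) + t * evalP M ⟦a⟧ (V i)    ≡⟨ sym (evalP-cf zeroLin (V i)) ⟩
      evalP M ρ (cf a (zeroLin , V i))                       ≡⟨ sym (⋀-elim _ _ ρ⊨V i) ⟩
      ⟦ 0ℚ ⟧ℚ                                                ≡⟨ ⟦0⟧ℚ ⟩
      0#                                                     ∎
      where
      δ0≡0 : evalP M σ (δ (lin zeroLin)) ≡ 0#
      δ0≡0 = trans (evalP-subst σ _ (lin (zeroLin {m}))) (evalP-lin-zeroLin {m} _)

    V-term : ∀ i → 0# ≤ Φ (V-summand i)
    V-term i = subst₂ _≤_ refl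
      (sym (trans (Φ-K-product (qs i) (V i)) (trans (cong (evalP M ⟦a⟧ (qs i) *_) (t*V≡0 i)) (zeroʳ _))))
      (≤-refl 0#)

    R-term : ∀ j → 0# ≤ Φ (R-summand j)
    R-term j = subst₂ _≤_ refl
      (sym (trans (Φ-scale (λs j) (embedDK (R j))) (cong (⟦ λs j ⟧ℚ *_) (Φ-embedDK (R j)))))
      (⟦⟧ℚ-*-nonneg (λs j) (0≤λs j) (subst₂ _≤_ ⟦0⟧ℚ refl (⋀-elim _ _ ρ⊨R j)))

  Φ-nonneg⇒bound : ∀ (r : LinForm m) p q → p ≈ₚ inv a q → 0# ≤ Φ (embedDK (r , q)) →
                   evalP M ρ (liftT ((lin r) ′)) ≤ evalP M ρ (liftT (unp (lin r)) ⊕ tvar ⊗ liftT (unp p))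
  Φ-nonneg⇒bound r p q p≈inv 0≤Φ = subst₂ _≤_
    (sym (evalP-ren ρ inj₁ ((lin r) ′)))
    (sym (cong₂ (λ x y → x + t * y) (evalP-ren ρ inj₁ (unp (lin r)))
                                     (trans (evalP-ren ρ inj₁ (unp p)) (evalP-unp-≈inv p q p≈inv))))
    (0≤y-x⇒x≤y (subst₂ _≤_ refl Φ≡ 0≤Φ))
    where
    ⟦r⟧ ⟦r′⟧ ⟦q⟧ : Carrier
    ⟦r⟧  = evalP M σ (unp (lin r))
    ⟦r′⟧ = evalP M σ ((lin r) ′)
    ⟦q⟧  = evalP M ⟦a⟧ q

    Φ≡ : Φ (embedDK (r , q)) ≡ (⟦r⟧ + t * ⟦q⟧) - ⟦r′⟧
    Φ≡ = begin
      Φ (embedDK (r , q))              ≡⟨ Φ-embedDK (r , q) ⟩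
      evalP M ρ (cf a (r , q))         ≡⟨ evalP-cf r q ⟩
      evalP M σ (δ (lin r)) + t * ⟦q⟧  ≡⟨ cong (_+ t * ⟦q⟧) (evalP-δ-lin σ r) ⟩
      (⟦r⟧ - ⟦r′⟧) + t * ⟦q⟧           ≡⟨ solve 4 (λ x y t z → x :- y :+ t :* z := x :+ t :* z :- y) refl ⟦r⟧ ⟦r′⟧ t ⟦q⟧ ⟩
      (⟦r⟧ + t * ⟦q⟧) - ⟦r′⟧           ∎

lemma5p3 : (m n nv nr : ℕ) (F : TransFormula m) (a : Fin n → LinForm m) →
             IsBasisLinInv F a →
             (V : Fin nv → Poly (Fin n)) (R : Fin nr → DK m n) →
             ModConeSpec F a V R →
             ((i : Fin nv) → F ⊨ᵀ (con 0ℚ =ᶠ δinv a (ren inj₂ (V i)))) →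
             (r : LinForm m) (p : Poly (Fin m)) → InRec F a r p →
             expF a V R ⊨ᴾ (liftT ((lin r) ′) ≤ᶠ liftT (unp (lin r)) ⊕ tvar ⊗ liftT (unp p))
lemma5p3 m n nv nr F a _ V R spec _ r p ((q , p≈inv) , F⊨r′≤r+p) M ρ ρ⊨exp =
  Φ-nonneg⇒bound r p q p≈inv (Φ-nonneg-on-cone V R ρ⊨exp dr+q∈cone)
  where
  open CfExtension M a ρ
  dr+q∈cone : InModCone V R (embedDK (r , q))
  dr+q∈cone = proj₂ (spec (embedDK (r , q))) (rec⇒Cn F a r p q p≈inv F⊨r′≤r+p , (r , q) , ≈-refl)
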